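{- Let $G$ be a non-complete chordal graph of order $n$ with clique number $d$, let $K_d=\{x_1,\ldots,x_d\}$ be a maximum clique, let $\sigma$ be an admissible PEO for $(G,K_d)$, and let $T=\alpha_\sigma(G)$. Then: (a) $d_i(T)\le d_i(G)$ for every $i=1,\ldots,d$; (b) $d_i(T)=d_i(G)$ for every $i>\widetilde{\kappa}(G)$.
   Context: Graphs are finite and simple; chordal means every cycle of length at least $4$ has a chord. A PEO (perfect elimination ordering) is a bijection $\sigma:\{1,\ldots,n\}\to V(G)$ such that each $\sigma(i)$ is simplicial (its neighbourhood is a clique) in the subgraph induced by $\{\sigma(i),\ldots,\sigma(n)\}$. $N_\sigma(v)=\{u\in N(v):\sigma^{ -1}(v)<\sigma^{ -1}(u)\}$, $n_\sigma(v)=|N_\sigma(v)|$, and for a maximal clique $C$, $s(C)=\{x\in C:N_\sigma(x)\not\subseteq C\}$. A PEO $\sigma$ is admissible for $(G,K_d)$ if: (a) every vertex outside $K_d$ precedes every vertex of $K_d$ and $\sigma^{ -1}(x_i)=n-i+1$ for $i=1,\ldots,d$; and for every maximal clique $C$: (b) $\sigma^{ -1}(u)<\sigma^{ -1}(v)$ for all $u\in C\setminus s(C)$, $v\in s(C)$; (c) if $|s(C)|<i\le|C|$ there is a unique $u\in C\setminus s(C)$ with $n_\sigma(u)=i-1$; (d) for every other maximal clique $C'$ with $C\cap C'\ne\emptyset$, either all of $C\setminus C'$ or all of $C'\setminus C$ precede all of $C\cap C'$ in $\sigma$. The graph $\alpha_\sigma(G)$ has vertex set $V(G)$ and edge set $\alpha_\sigma(E(G))$,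 where $\alpha_\sigma(uv)=uv$ for edges inside $K_d$, and for $u\notin K_d$ with $N_\sigma(u)=\{u_1,\ldots,u_{n_\sigma(u)}\}$ listed so that $\sigma^{ -1}(u_1)<\cdots<\sigma^{ -1}(u_{n_\sigma(u)})$, $\alpha_\sigma(uu_i)=ux_i$. A clique $C$ dominates a clique $C'$ if $C\subseteq C'$; a dominating $i$--clique of a graph $H$ is a set of $i$--cliques of $H$ such that every maximal clique of order at least $i$ is dominated by one of them; $d_i(H)$ is the minimum size of a dominating $i$--clique. $\widetilde{\kappa}(G)=\max\{|C\cap C'|: C,C'\text{ maximal cliques of }G\}$ (over pairs of distinct maximal cliques). -}

module Defs where

open import Data.Bool using (Bool; true; false; _∧_; not)
open import Data.Nat using (ℕ; zero; suc; _≤_; _<_; _∸_; _<ᵇ_)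
open import Data.Fin using (Fin; toℕ)
open import Data.Fin.Subset using (Subset; _∈_; _∉_; _⊆_; _∩_; ∣_∣)
open import Data.Fin.Subset.Properties using (_∈?_; _⊆?_)
open import Data.Fin.Permutation using (Permutation′; _⟨$⟩ʳ_; _⟨$⟩ˡ_)
open import Data.Vec using (tabulate)
open import Data.List using (List; length)
open import Data.List.Relation.Unary.All using (All)
open import Data.List.Relation.Unary.Any using (Any)
open import Data.List.Relation.Unary.Unique.Propositional using (Unique)
open import Data.Product using (Σ; ∃; _×_)
open import Data.Sum using (_⊎_)
open import Function.Definitions using (Injective)
open import Relation.Nullary using (¬_; does)
open import Relation.Binary.PropositionalEquality using (_≡_; _≢_)

record SimpleGraph (n : ℕ) : Set where
  field
    E     : Fin n → Fin n → Bool
    E-sym : ∀ u v → E u v ≡ E v u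
    E-irr : ∀ v → E v v ≡ false

open SimpleGraph public

Adj : ∀ {n} → SimpleGraph n → Fin n → Fin n → Set
Adj G u v = E G u v ≡ true

Rel : ℕ → Set₁
Rel n = Fin n → Fin n → Set

IsClique : ∀ {n} → Rel n → Subset n → Set
IsClique R C = ∀ {u v} → u ∈ C → v ∈ C → u ≢ v → R u v

IsMaximalClique : ∀ {n} → Rel n → Subset n → Set
IsMaximalClique R C = IsClique R C × (∀ C′ → IsClique R C′ → C ⊆ C′ → C′ ⊆ C)

IsICliqueOf : ∀ {n} → Rel n → ℕ → Subset n → Set
IsICliqueOf R i C = IsClique R C × ∣ C ∣ ≡ i

-- a dominating i-clique: a (duplicate-free list representing a) set of
-- i-cliques such that every maximal clique of order ≥ i contains one of them
IsDominatingIClique : ∀ {n} → Rel n → ℕ → List (Subset n) → Set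
IsDominatingIClique R i D =
  Unique D × All (IsICliqueOf R i) D ×
  (∀ C → IsMaximalClique R C → i ≤ ∣ C ∣ → Any (λ D₀ → D₀ ⊆ C) D)

IsDominationNumber : ∀ {n} → Rel n → ℕ → ℕ → Set
IsDominationNumber R i m =
  (Σ (List _) λ D → IsDominatingIClique R i D × length D ≡ m) ×
  (∀ D → IsDominatingIClique R i D → m ≤ length D)

IsCliqueNumber : ∀ {n} → Rel n → ℕ → Set
IsCliqueNumber R d =
  (Σ (Subset _) λ C → IsClique R C × ∣ C ∣ ≡ d) ×
  (∀ C → IsClique R C → ∣ C ∣ ≤ d)

IsKappaTilde : ∀ {n} → Rel n → ℕ → Set
IsKappaTilde R k =
  (Σ (Subset _) λ C → Σ (Subset _) λ C′ →
     IsMaximalClique R C × IsMaximalClique R C′ × C ≢ C′ × ∣ C ∩ C′ ∣ ≡ k) ×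
  (∀ C C′ → IsMaximalClique R C → IsMaximalClique R C′ → C ≢ C′ →
     ∣ C ∩ C′ ∣ ≤ k)

CycAdj : ∀ k → Fin k → Fin k → Set
CycAdj k i j = (toℕ j ≡ suc (toℕ i)) ⊎ (suc (toℕ i) ≡ k × toℕ j ≡ 0)

IsChordal : ∀ {n} → SimpleGraph n → Set
IsChordal {n} G =
  ∀ k → 4 ≤ k → (c : Fin k → Fin n) → Injective _≡_ _≡_ c →
  (∀ i j → CycAdj k i j → Adj G (c i) (c j)) →
  ∃ λ i → ∃ λ j → i ≢ j × ¬ CycAdj k i j × ¬ CycAdj k j i × Adj G (c i) (c j)

IsComplete : ∀ {n} → SimpleGraph n → Set
IsComplete G = ∀ u v → u ≢ v → Adj G u v

-- Orderings. σ : positions → vertices (0-indexed), pos = σ⁻¹.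

module _ {n : ℕ} (G : SimpleGraph n) (σ : Permutation′ n) where

  pos : Fin n → Fin n
  pos v = σ ⟨$⟩ˡ v

  _≺_ : Fin n → Fin n → Set
  u ≺ v = toℕ (pos u) < toℕ (pos v)

  Nσ : Fin n → Subset n
  Nσ v = tabulate λ u → E G v u ∧ (toℕ (pos v) <ᵇ toℕ (pos u))

  nσ : Fin n → ℕ
  nσ v = ∣ Nσ v ∣

  -- perfect elimination ordering: σ(i) is simplicial in G[σ(i),…,σ(n)],
  -- i.e. its later neighbourhood N_σ(σ(i)) is a clique
  IsPEO : Set
  IsPEO = ∀ v → IsClique (Adj G) (Nσ v)

  s : Subset n → Subset n
  s C = tabulate λ x → does (x ∈? C) ∧ not (does (Nσ x ⊆? C))

  module _ {d : ℕ} (x : Fin d → Fin n) where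

    InK : Fin n → Set
    InK v = ∃ λ i → x i ≡ v

    record IsAdmissible : Set where
      field
        peo : IsPEO
        -- (a)  (paper's x_{i+1} is x i; paper position p is toℕ index p-1)
        adm-a₁ : ∀ u v → ¬ InK u → InK v → u ≺ v
        adm-a₂ : ∀ (i : Fin d) → toℕ (pos (x i)) ≡ n ∸ suc (toℕ i)
        adm-b : ∀ C → IsMaximalClique (Adj G) C →
                ∀ u v → u ∈ C → u ∉ s C → v ∈ s C → u ≺ v
        adm-c : ∀ C → IsMaximalClique (Adj G) C →
                ∀ i → ∣ s C ∣ < i → i ≤ ∣ C ∣ →
                Σ (Fin n) λ u → (u ∈ C × u ∉ s C × nσ u ≡ i ∸ 1) ×
                  (∀ w → w ∈ C → w ∉ s C → nσ w ≡ i ∸ 1 → w ≡ u)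
        adm-d : ∀ C C′ → IsMaximalClique (Adj G) C → IsMaximalClique (Adj G) C′ →
                C ≢ C′ → (∃ λ z → z ∈ C × z ∈ C′) →
                (∀ a b → a ∈ C → a ∉ C′ → b ∈ C → b ∈ C′ → a ≺ b) ⊎
                (∀ a b → a ∈ C′ → a ∉ C → b ∈ C → b ∈ C′ → a ≺ b)

    -- rank (0-based) of v within N_σ(u) ordered by σ:
    -- number of w ∈ N_σ(u) preceding v
    rank : Fin n → Fin n → ℕ
    rank u v = ∣ tabulate (λ w → E G u w ∧ (toℕ (pos u) <ᵇ toℕ (pos w))
                                          ∧ (toℕ (pos w) <ᵇ toℕ (pos v))) ∣

    -- the image α_σ(uv) of the edge uv, as an ordered pair
    --  * edges inside K_d are kept;
    --  * for u ∉ K_d and v = u_{r+1} ∈ N_σ(u) (r = rank u v), uv ↦ u x_{r+1}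
    data αImage : Fin n → Fin n → Set where
      keep : ∀ {u v} → Adj G u v → InK u → InK v → αImage u v
      move : ∀ {u v} (i : Fin d) → Adj G u v → ¬ InK u → u ≺ v →
             toℕ i ≡ rank u v → αImage u (x i)

    αAdj : Rel n
    αAdj a b = αImage a b ⊎ αImage b a

module Submission where

-- Write i = k + 1 and let L be the set of vertices u with nσ(u) = k; its only vertex in K_d is x_i.
-- In T = α_σ(G) a vertex u ∉ K_d is adjacent exactly to x_1, …, x_{nσ(u)}, so every maximal clique
-- of T is K_d or a fan {x_1, …, x_{nσ(u)}, u}. Those of order ≥ i are dominated by the i-cliques
-- {x_1, …, x_k, u}, u ∈ L, and no i-clique lies in two of the maximal cliques K_d and
-- {x_1, …, x_k, u}, u ∈ L ∖ K_d. Hence d_i(T) = |L|.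
-- In G each u ∈ L has its closed forward neighbourhood N_σ[u] inside some maximal clique C_u,
-- and conditions (b)–(d) of admissibility show that an i-clique contained in C_u and C_v forces
-- u = v; so d_i(G) ≥ |L|. Conversely |s(C)| ≤ κ̃(G) for every maximal clique C (the first vertex
-- of s(C) has its N_σ[·] in another maximal clique containing s(C)), so for i > κ̃(G) condition (c)
-- provides u ∈ L with N_σ[u] ⊆ C, and the cliques N_σ[u], u ∈ L, dominate G: d_i(G) = |L|.
-- For i > d both domination numbers are 0.

open import Defs hiding (pos; _≺_; Nσ; nσ; s; InK; rank)
import Defs as D
open import Data.Bool using (Bool; true; false; _∧_; not; T)
open import Data.Bool.Properties using (T-≡; T-∧; T-not-≡) renaming (_≟_ to _≟ᵇ_)
open import Data.Fin using (Fin; toℕ; zero; suc; fromℕ<)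
open import Data.Fin.Permutation using (Permutation′; _⟨$⟩ʳ_; inverseʳ)
open import Data.Fin.Properties using (any?; all?; injective⇒≤; toℕ-injective; toℕ<n; toℕ-fromℕ<)
  renaming (_≟_ to _≟ᶠ_)
open import Data.Fin.Subset using (Subset; _∈_; _∉_; _⊆_; _∪_; _∩_; ⁅_⁆; ∣_∣; Nonempty; Empty)
open import Data.Fin.Subset.Properties
open import Data.List using (List; []; _∷_; length; map; filter; allFin)
import Data.List as List
open import Data.List.Membership.Propositional using (lose) renaming (_∈_ to _∈ˡ_)
open import Data.List.Membership.Propositional.Properties using (∈-lookup; ∈-filter⁺; ∈-filter⁻; ∈-allFin)
open import Data.List.Properties using (length-map)
open import Data.List.Relation.Unary.All as All using (All; []; _∷_)
import Data.List.Relation.Unary.All.Properties as All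
open import Data.List.Relation.Unary.Any as Any using (Any)
import Data.List.Relation.Unary.Any.Properties as Any
open import Data.List.Relation.Unary.AllPairs using ([]; _∷_)
open import Data.List.Relation.Unary.Unique.Propositional using (Unique)
import Data.List.Relation.Unary.Unique.Propositional.Properties as Unique
open import Data.Nat using (ℕ; zero; suc; _≤_; _<_; _+_; z≤n; s≤s; s≤s⁻¹; _≤?_; _<?_; _≟_; _<ᵇ_)
open import Data.Nat.Properties
open import Data.Product using (∃; _×_; _,_; proj₁; proj₂)
open import Data.Sum using (_⊎_; inj₁; inj₂; map₂; swap)
open import Data.Vec using (_∷_; tabulate; here; there)
open import Data.Vec.Properties using (lookup∘tabulate; []=⇒lookup; lookup⇒[]=; ≡-dec)
open import Function using (_∘_; id; Equivalence)
open import Function.Definitions using (Injective)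
open import Level using (0ℓ)
open import Relation.Binary using (tri<; tri≈; tri>)
open import Relation.Binary.PropositionalEquality
open import Relation.Nullary using (¬_; Dec; yes; no; does; contradiction; ¬?)
open import Relation.Nullary.Decidable
  using (_×-dec_; _→-dec_; isYes; toWitness; fromWitness; dec-true; dec-false; decidable-stable)
open import Relation.Unary using (Pred; Decidable)

open Equivalence using (to; from)

-- Finite subsets and lists

T-does⇒ : ∀ {P : Set} (P? : Dec P) → T (does P?) → P
T-does⇒ (yes p) _ = p

T-not-does⇒ : ∀ {P : Set} (P? : Dec P) → T (not (does P?)) → ¬ P
T-not-does⇒ (no ¬p) _ = ¬p

∈-tabulate⁻ : ∀ {n} {f : Fin n → Bool} {v} → v ∈ tabulate f → T (f v)
∈-tabulate⁻ {f = f} {v} v∈ = from T-≡ (trans (sym (lookup∘tabulate f v)) ([]=⇒lookup v∈))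

∈-tabulate⁺ : ∀ {n} {f : Fin n → Bool} {v} → T (f v) → v ∈ tabulate f
∈-tabulate⁺ {f = f} {v} t = lookup⇒[]= v (tabulate f) (trans (lookup∘tabulate f v) (to T-≡ t))

x∈p∪⁅y⁆⁻ : ∀ {n} {p : Subset n} {x y} → x ∈ p ∪ ⁅ y ⁆ → x ∈ p ⊎ x ≡ y
x∈p∪⁅y⁆⁻ {p = p} {y = y} x∈ = map₂ (x∈⁅y⁆⇒x≡y y) (x∈p∪q⁻ p ⁅ y ⁆ x∈)

y∈p∪⁅y⁆ : ∀ {n} (p : Subset n) y → y ∈ p ∪ ⁅ y ⁆
y∈p∪⁅y⁆ p y = x∈p∪q⁺ (inj₂ (x∈⁅x⁆ y))

x∉p⇒∣p∪⁅x⁆∣≡1+∣p∣ : ∀ {n} {p : Subset n} {x} → x ∉ p → ∣ p ∪ ⁅ x ⁆ ∣ ≡ suc ∣ p ∣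
x∉p⇒∣p∪⁅x⁆∣≡1+∣p∣ {p = false ∷ p} {zero}  _  = cong (suc ∘ ∣_∣) (∪-identityʳ p)
x∉p⇒∣p∪⁅x⁆∣≡1+∣p∣ {p = true ∷ p}  {zero}  x∉ = contradiction here x∉
x∉p⇒∣p∪⁅x⁆∣≡1+∣p∣ {p = false ∷ p} {suc x} x∉ = x∉p⇒∣p∪⁅x⁆∣≡1+∣p∣ (x∉ ∘ there)
x∉p⇒∣p∪⁅x⁆∣≡1+∣p∣ {p = true ∷ p}  {suc x} x∉ = cong suc (x∉p⇒∣p∪⁅x⁆∣≡1+∣p∣ (x∉ ∘ there))

p⊆q∧∣q∣≤∣p∣⇒q⊆p : ∀ {n} {p q : Subset n} → p ⊆ q → ∣ q ∣ ≤ ∣ p ∣ → q ⊆ p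
p⊆q∧∣q∣≤∣p∣⇒q⊆p {p = p} p⊆q ∣q∣≤∣p∣ {x} x∈q =
  decidable-stable (x ∈? p) λ x∉p → ≤⇒≯ ∣q∣≤∣p∣ (p⊂q⇒∣p∣<∣q∣ (p⊆q , x , x∈q , x∉p))

Empty⇒∣p∣≡0 : ∀ {n} {p : Subset n} → Empty p → ∣ p ∣ ≡ 0
Empty⇒∣p∣≡0 {n} empty = trans (cong ∣_∣ (Empty-unique empty)) (∣⊥∣≡0 n)

∣p∣>0⇒Nonempty : ∀ {n} {p : Subset n} → 0 < ∣ p ∣ → Nonempty p
∣p∣>0⇒Nonempty {p = p} 0<∣p∣ = decidable-stable (nonempty? p) λ empty → >⇒≢ 0<∣p∣ (Empty⇒∣p∣≡0 empty)

p⊈q⇒∃ : ∀ {n} {p q : Subset n} → ¬ p ⊆ q → ∃ λ x → x ∈ p × x ∉ q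
p⊈q⇒∃ {p = p} {q} p⊈q = decidable-stable (any? λ x → x ∈? p ×-dec ¬? (x ∈? q)) λ none →
  p⊈q λ {x} x∈p → decidable-stable (x ∈? q) λ x∉q → none (x , x∈p , x∉q)

argmin : ∀ {n} {P : Pred (Fin n) 0ℓ} → Decidable P → (f : Fin n → ℕ) → ∃ P →
         ∃ λ v → P v × (∀ w → P w → f v ≤ f w)
argmin {zero} _ _ (() , _)
argmin {suc n} {P} P? f ∃P with any? (P? ∘ suc)
... | no ¬P∘suc = zero , P0 ∃P , λ { zero _ → ≤-refl ; (suc w) Pw → contradiction (w , Pw) ¬P∘suc }
  where
  P0 : ∃ P → P zero
  P0 (zero , p)  = p
  P0 (suc v , p) = contradiction (v , p) ¬P∘suc
... | yes ∃P∘suc with argmin (P? ∘ suc) (f ∘ suc) ∃P∘suc | P? zero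
...   | v , Pv , least | no ¬P0 = suc v , Pv , λ { zero P0 → contradiction P0 ¬P0 ; (suc w) Pw → least w Pw }
...   | v , Pv , least | yes P0 with f zero ≤? f (suc v)
...     | yes f0≤ = zero , P0 , λ { zero _ → ≤-refl ; (suc w) Pw → ≤-trans f0≤ (least w Pw) }
...     | no f0≰ = suc v , Pv , λ { zero _ → <⇒≤ (≰⇒> f0≰) ; (suc w) Pw → least w Pw }

module _ {A B : Set} where

  lookup-injective : ∀ {xs : List A} → Unique xs → ∀ {i j} → List.lookup xs i ≡ List.lookup xs j → i ≡ j
  lookup-injective (_ ∷ _)     {zero}  {zero}  _ = refl
  lookup-injective (x∉xs ∷ _)  {zero}  {suc j} e = contradiction e (All.lookup x∉xs (∈-lookup j))
  lookup-injective (x∉xs ∷ _)  {suc i} {zero}  e = contradiction (sym e) (All.lookup x∉xs (∈-lookup i))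
  lookup-injective (_ ∷ uniq)  {suc i} {suc j} e = cong suc (lookup-injective uniq e)

  matching⇒length≤ : ∀ {L : List A} {D : List B} (R : A → B → Set) → Unique L →
    (∀ {a} → a ∈ˡ L → Any (R a) D) →
    (∀ {a a′ b} → a ∈ˡ L → a′ ∈ˡ L → b ∈ˡ D → R a b → R a′ b → a ≡ a′) →
    length L ≤ length D
  matching⇒length≤ {L} {D} R uniq match unshared = injective⇒≤ {f = choice} choice-injective
    where
    choice : Fin (length L) → Fin (length D)
    choice i = Any.index (match (∈-lookup i))
    choice-injective : Injective _≡_ _≡_ choice
    choice-injective {i} {j} e = lookup-injective uniq
      (unshared (∈-lookup i) (∈-lookup j) (∈-lookup (choice i)) (Any.lookup-index (match (∈-lookup i)))
        (subst (λ c → R (List.lookup L j) (List.lookup D c)) (sym e) (Any.lookup-index (match (∈-lookup j)))))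

  Unique-map⁺ : ∀ (f : A → B) {xs : List A} → Unique xs →
    (∀ {a b} → a ∈ˡ xs → b ∈ˡ xs → f a ≡ f b → a ≡ b) → Unique (map f xs)
  Unique-map⁺ f []            _   = []
  Unique-map⁺ f (x∉xs ∷ uniq) inj =
    All.map⁺ (All.tabulate λ y∈ fx≡fy → All.lookup x∉xs y∈ (inj (Any.here refl) (Any.there y∈) fx≡fy))
    ∷ Unique-map⁺ f uniq λ a∈ b∈ → inj (Any.there a∈) (Any.there b∈)

-- Cliques and domination numbers

module _ {n : ℕ} {R : Rel n} where

  ⁅⁆-clique : ∀ {v} → IsClique R ⁅ v ⁆
  ⁅⁆-clique {v} a∈ b∈ a≢b = contradiction (trans (x∈⁅y⁆⇒x≡y v a∈) (sym (x∈⁅y⁆⇒x≡y v b∈))) a≢b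

  maximum⇒maximal : ∀ {d C} → (∀ C′ → IsClique R C′ → ∣ C′ ∣ ≤ d) → IsClique R C → ∣ C ∣ ≡ d →
                    IsMaximalClique R C
  maximum⇒maximal bound cl ∣C∣≡d =
    cl , λ C′ cl′ C⊆C′ → p⊆q∧∣q∣≤∣p∣⇒q⊆p C⊆C′ (subst (∣ C′ ∣ ≤_) (sym ∣C∣≡d) (bound C′ cl′))

  module _ (R-sym : ∀ {u v} → R u v → R v u) where

    ∪-clique : ∀ {B C} → IsClique R C → IsClique R B → (∀ {a b} → a ∈ C → b ∈ B → a ≢ b → R a b) →
               IsClique R (C ∪ B)
    ∪-clique {B} {C} clC clB cross {a} {b} a∈ b∈ a≢b with x∈p∪q⁻ C B a∈ | x∈p∪q⁻ C B b∈
    ... | inj₁ a∈C | inj₁ b∈C = clC a∈C b∈C a≢b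
    ... | inj₁ a∈C | inj₂ b∈B = cross a∈C b∈B a≢b
    ... | inj₂ a∈B | inj₁ b∈C = R-sym (cross b∈C a∈B (a≢b ∘ sym))
    ... | inj₂ a∈B | inj₂ b∈B = clB a∈B b∈B a≢b

    ⊆-maximal : ∀ {B C} → IsMaximalClique R C → IsClique R B →
                (∀ {a b} → a ∈ C → b ∈ B → a ≢ b → R a b) → B ⊆ C
    ⊆-maximal {B} {C} (clC , maximal) clB cross b∈B =
      maximal (C ∪ B) (∪-clique clC clB cross) (p⊆p∪q B) (x∈p∪q⁺ (inj₂ b∈B))

  dominationNumber≤ : ∀ {i m D} → IsDominationNumber R i m → IsDominatingIClique R i D → m ≤ length D
  dominationNumber≤ (_ , minimal) = minimal _

  ≤dominationNumber : ∀ {i m k} → IsDominationNumber R i m →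
                      (∀ D → IsDominatingIClique R i D → k ≤ length D) → k ≤ m
  ≤dominationNumber ((D , dominating , refl) , _) lower = lower D dominating

  dominationNumber-vanishes : ∀ {i m} → (∀ C → IsClique R C → ∣ C ∣ < i) → IsDominationNumber R i m → m ≡ 0
  dominationNumber-vanishes small (_ , minimal) =
    n≤0⇒n≡0 (minimal [] ([] , [] , λ C (cl , _) i≤∣C∣ → contradiction i≤∣C∣ (<⇒≱ (small C cl))))

module _ {n : ℕ} (G : SimpleGraph n) where

  Adj-sym : ∀ {u v} → Adj G u v → Adj G v u
  Adj-sym {u} {v} = trans (E-sym G v u)

  extendToMaximal : ∀ {C} → IsClique (Adj G) C → ∃ λ C′ → IsMaximalClique (Adj G) C′ × C ⊆ C′
  extendToMaximal {C} cl = extend n cl (m≤n+m n ∣ C ∣)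
    where
    -- k is fuel: adding vertices one at a time, n ≤ ∣ C ∣ + k stays true
    extend : ∀ k {C} → IsClique (Adj G) C → n ≤ ∣ C ∣ + k →
             ∃ λ C′ → IsMaximalClique (Adj G) C′ × C ⊆ C′
    extend k {C} cl n≤ with any? (λ v → ¬? (v ∈? C) ×-dec all? λ w → w ∈? C →-dec (E G v w ≟ᵇ true))
    ... | no none = C , (cl , maximal) , id
      where
      maximal : ∀ C′ → IsClique (Adj G) C′ → C ⊆ C′ → C′ ⊆ C
      maximal C′ cl′ C⊆C′ {v} v∈C′ = decidable-stable (v ∈? C) λ v∉C →
        none (v , v∉C , λ w w∈C → cl′ v∈C′ (C⊆C′ w∈C) λ v≡w → v∉C (subst (_∈ C) (sym v≡w) w∈C))
    ... | yes (v , v∉C , v~C) = grow k n≤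
      where
      cl⁺ : IsClique (Adj G) (C ∪ ⁅ v ⁆)
      cl⁺ = ∪-clique Adj-sym cl (⁅⁆-clique {R = Adj G}) λ {a} a∈C b∈ _ →
        subst (Adj G a) (sym (x∈⁅y⁆⇒x≡y v b∈)) (Adj-sym (v~C a a∈C))
      grow : ∀ k → n ≤ ∣ C ∣ + k → ∃ λ C′ → IsMaximalClique (Adj G) C′ × C ⊆ C′
      grow zero n≤∣C∣+0 = contradiction
        (≤-trans (subst (_≤ n) (x∉p⇒∣p∪⁅x⁆∣≡1+∣p∣ v∉C) (∣p∣≤n (C ∪ ⁅ v ⁆)))
                 (subst (n ≤_) (+-identityʳ ∣ C ∣) n≤∣C∣+0))
        (<-irrefl refl)
      grow (suc k) n≤ with extend k cl⁺ (subst (n ≤_) (trans (+-suc ∣ C ∣ k)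
                              (cong (_+ k) (sym (x∉p⇒∣p∪⁅x⁆∣≡1+∣p∣ v∉C)))) n≤)
      ... | C′ , maximal , C⁺⊆C′ = C′ , maximal , C⁺⊆C′ ∘ p⊆p∪q ⁅ v ⁆

-- Vertex orderings

module Ordering {n : ℕ} (G : SimpleGraph n) (σ : Permutation′ n) where

  pos : Fin n → ℕ
  pos v = toℕ (D.pos G σ v)

  _≺_ : Fin n → Fin n → Set
  _≺_ = D._≺_ G σ

  Nσ : Fin n → Subset n
  Nσ = D.Nσ G σ

  nσ : Fin n → ℕ
  nσ = D.nσ G σ

  s : Subset n → Subset n
  s = D.s G σ

  pos-injective : ∀ {v w} → pos v ≡ pos w → v ≡ w
  pos-injective e = trans (sym (inverseʳ σ)) (trans (cong (σ ⟨$⟩ʳ_) (toℕ-injective e)) (inverseʳ σ))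

  ≢⇒≺⊎≻ : ∀ {v w} → v ≢ w → v ≺ w ⊎ w ≺ v
  ≢⇒≺⊎≻ {v} {w} v≢w with <-cmp (pos v) (pos w)
  ... | tri< v≺w _ _ = inj₁ v≺w
  ... | tri≈ _ e _   = contradiction (pos-injective e) v≢w
  ... | tri> _ _ w≺v = inj₂ w≺v

  ∈Nσ⁻ : ∀ {u w} → w ∈ Nσ u → Adj G u w × u ≺ w
  ∈Nσ⁻ {u} {w} w∈ with to T-∧ (∈-tabulate⁻ w∈)
  ... | adj , u≺w = to T-≡ adj , <ᵇ⇒< (pos u) (pos w) u≺w

  ∈Nσ⁺ : ∀ {u w} → Adj G u w → u ≺ w → w ∈ Nσ u
  ∈Nσ⁺ adj u≺w = ∈-tabulate⁺ (from T-∧ (from T-≡ adj , <⇒<ᵇ u≺w))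

  u∉Nσu : ∀ {u} → u ∉ Nσ u
  u∉Nσu u∈ = <-irrefl refl (proj₂ (∈Nσ⁻ u∈))

  Nσ[_] : Fin n → Subset n
  Nσ[ u ] = Nσ u ∪ ⁅ u ⁆

  ∣Nσ[u]∣≡1+nσu : ∀ u → ∣ Nσ[ u ] ∣ ≡ suc (nσ u)
  ∣Nσ[u]∣≡1+nσu u = x∉p⇒∣p∪⁅x⁆∣≡1+∣p∣ u∉Nσu

  Nσ[]⊆⇒∈ : ∀ {u C} → Nσ[ u ] ⊆ C → u ∈ C
  Nσ[]⊆⇒∈ {u} Nσ[u]⊆C = Nσ[u]⊆C (y∈p∪⁅y⁆ _ u)

  Nσ[]⊆⇒Nσ⊆ : ∀ {u C} → Nσ[ u ] ⊆ C → Nσ u ⊆ C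
  Nσ[]⊆⇒Nσ⊆ {u} Nσ[u]⊆C = Nσ[u]⊆C ∘ p⊆p∪q ⁅ u ⁆

  Nσ[]⊆⁺ : ∀ {u C} → u ∈ C → Nσ u ⊆ C → Nσ[ u ] ⊆ C
  Nσ[]⊆⁺ u∈C Nσu⊆C v∈ with x∈p∪⁅y⁆⁻ v∈
  ... | inj₁ v∈Nσu = Nσu⊆C v∈Nσu
  ... | inj₂ refl  = u∈C

  Nσ[]-injective : ∀ {u v} → Nσ[ u ] ≡ Nσ[ v ] → u ≡ v
  Nσ[]-injective {u} {v} e with x∈p∪⁅y⁆⁻ (subst (u ∈_) e (y∈p∪⁅y⁆ _ u))
                              | x∈p∪⁅y⁆⁻ (subst (v ∈_) (sym e) (y∈p∪⁅y⁆ _ v))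
  ... | inj₂ u≡v | _        = u≡v
  ... | inj₁ _   | inj₂ v≡u = sym v≡u
  ... | inj₁ u∈  | inj₁ v∈  = contradiction (proj₂ (∈Nσ⁻ u∈)) (<-asym (proj₂ (∈Nσ⁻ v∈)))

  Nσ[]-clique : IsPEO G σ → ∀ u → IsClique (Adj G) Nσ[ u ]
  Nσ[]-clique peo u = ∪-clique (Adj-sym G) (peo u) (⁅⁆-clique {R = Adj G}) λ a∈ b∈ _ →
    subst (Adj G _) (sym (x∈⁅y⁆⇒x≡y u b∈)) (Adj-sym G (proj₁ (∈Nσ⁻ a∈)))

  -- rank agrees with Defs.rank, which does not depend on x
  earlier : Fin n → Fin n → Subset n
  earlier u w = tabulate λ v → E G u v ∧ (pos u <ᵇ pos v) ∧ (pos v <ᵇ pos w)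

  rank : Fin n → Fin n → ℕ
  rank u w = ∣ earlier u w ∣

  ∈earlier⁻ : ∀ {u w v} → v ∈ earlier u w → v ∈ Nσ u × v ≺ w
  ∈earlier⁻ {u} {w} {v} v∈ with to T-∧ (∈-tabulate⁻ v∈)
  ... | adj , rest with to T-∧ rest
  ...   | u≺v , v≺w = ∈Nσ⁺ (to T-≡ adj) (<ᵇ⇒< (pos u) (pos v) u≺v) , <ᵇ⇒< (pos v) (pos w) v≺w

  ∈earlier⁺ : ∀ {u w v} → v ∈ Nσ u → v ≺ w → v ∈ earlier u w
  ∈earlier⁺ v∈ v≺w with ∈Nσ⁻ v∈
  ... | adj , u≺v = ∈-tabulate⁺ (from T-∧ (from T-≡ adj , from T-∧ (<⇒<ᵇ u≺v , <⇒<ᵇ v≺w)))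

  w∉earlier : ∀ {u w} → w ∉ earlier u w
  w∉earlier = <-irrefl refl ∘ proj₂ ∘ ∈earlier⁻

  rank<nσ : ∀ {u w} → w ∈ Nσ u → rank u w < nσ u
  rank<nσ w∈ = p⊂q⇒∣p∣<∣q∣ (proj₁ ∘ ∈earlier⁻ , _ , w∈ , w∉earlier)

  first : ∀ {u} → 0 < nσ u → ∃ λ w → w ∈ Nσ u × Empty (earlier u w)
  first {u} 0<nσu with argmin (_∈? Nσ u) pos (∣p∣>0⇒Nonempty 0<nσu)
  ... | w , w∈ , least = w , w∈ , λ (v , v∈) →
    <⇒≱ (proj₂ (∈earlier⁻ v∈)) (least v (proj₁ (∈earlier⁻ v∈)))

  next : ∀ {u w} → w ∈ Nσ u → suc (rank u w) < nσ u →
         ∃ λ w′ → w′ ∈ Nσ u × earlier u w′ ≡ earlier u w ∪ ⁅ w ⁆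
  next {u} {w} w∈ 1+rank<nσ = w′ , w′∈ , ⊆-antisym ⊆B B⊆
    where
    B : Subset n
    B = earlier u w ∪ ⁅ w ⁆
    beyond : ∃ λ w₁ → w₁ ∈ Nσ u × w₁ ∉ B
    beyond = p⊈q⇒∃ λ Nσu⊆B →
      ≤⇒≯ (subst (nσ u ≤_) (x∉p⇒∣p∪⁅x⁆∣≡1+∣p∣ w∉earlier) (p⊆q⇒∣p∣≤∣q∣ Nσu⊆B)) 1+rank<nσ
    w≺w₁ : w ≺ proj₁ beyond
    w≺w₁ with beyond
    ... | w₁ , w₁∈ , w₁∉B with ≢⇒≺⊎≻ {w} {w₁} (λ { refl → w₁∉B (y∈p∪⁅y⁆ _ w) })
    ...   | inj₁ w≺w₁ = w≺w₁
    ...   | inj₂ w₁≺w = contradiction (p⊆p∪q ⁅ w ⁆ (∈earlier⁺ w₁∈ w₁≺w)) w₁∉B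
    least : ∃ λ w′ → (w′ ∈ Nσ u × w ≺ w′) × (∀ v → v ∈ Nσ u × w ≺ v → pos w′ ≤ pos v)
    least = argmin (λ v → v ∈? Nσ u ×-dec pos w <? pos v) pos
                   (proj₁ beyond , proj₁ (proj₂ beyond) , w≺w₁)
    w′ : Fin n
    w′ = proj₁ least
    w′∈ : w′ ∈ Nσ u
    w′∈ = proj₁ (proj₁ (proj₂ least))
    w≺w′ : w ≺ w′
    w≺w′ = proj₂ (proj₁ (proj₂ least))
    ⊆B : earlier u w′ ⊆ B
    ⊆B {v} v∈ with ∈earlier⁻ v∈ | v ≟ᶠ w
    ... | _ , _ | yes refl = y∈p∪⁅y⁆ _ v
    ... | v∈Nσ , v≺w′ | no v≢w with ≢⇒≺⊎≻ v≢w
    ...   | inj₁ v≺w = p⊆p∪q ⁅ w ⁆ (∈earlier⁺ v∈Nσ v≺w)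
    ...   | inj₂ w≺v = contradiction v≺w′ (≤⇒≯ (proj₂ (proj₂ least) v (v∈Nσ , w≺v)))
    B⊆ : B ⊆ earlier u w′
    B⊆ v∈ with x∈p∪⁅y⁆⁻ v∈
    ... | inj₁ v∈earlier = ∈earlier⁺ (proj₁ (∈earlier⁻ v∈earlier)) (<-trans (proj₂ (∈earlier⁻ v∈earlier)) w≺w′)
    ... | inj₂ refl = ∈earlier⁺ w∈ w≺w′

  rank-surjective : ∀ r {u} → r < nσ u → ∃ λ w → w ∈ Nσ u × rank u w ≡ r
  rank-surjective zero r<nσ with first r<nσ
  ... | w , w∈ , empty = w , w∈ , Empty⇒∣p∣≡0 empty
  rank-surjective (suc r) r<nσ with rank-surjective r (<-trans (n<1+n r) r<nσ)
  ... | w , w∈ , refl with next w∈ r<nσ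
  ...   | w′ , w′∈ , e = w′ , w′∈ , trans (cong ∣_∣ e) (x∉p⇒∣p∪⁅x⁆∣≡1+∣p∣ w∉earlier)

  ∈s⁻ : ∀ {C v} → v ∈ s C → v ∈ C × ¬ Nσ v ⊆ C
  ∈s⁻ {C} {v} v∈ with to T-∧ (∈-tabulate⁻ v∈)
  ... | v∈C , Nσv⊈C = T-does⇒ (v ∈? C) v∈C , T-not-does⇒ (Nσ v ⊆? C) Nσv⊈C

  s⊆ : ∀ {C} → s C ⊆ C
  s⊆ = proj₁ ∘ ∈s⁻

  Nσ⊆⇒∉s : ∀ {C v} → Nσ v ⊆ C → v ∉ s C
  Nσ⊆⇒∉s Nσv⊆C v∈s = proj₂ (∈s⁻ v∈s) Nσv⊆C

  ∉s⇒Nσ⊆ : ∀ {C v} → v ∈ C → v ∉ s C → Nσ v ⊆ C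
  ∉s⇒Nσ⊆ {C} {v} v∈C v∉s = decidable-stable (Nσ v ⊆? C) λ Nσv⊈C → v∉s (∈-tabulate⁺
    (from T-∧ (from T-≡ (dec-true (v ∈? C) v∈C) , from T-not-≡ (dec-false (Nσ v ⊆? C) Nσv⊈C))))

  s⊆overlap : ∀ {C} → IsPEO G σ → IsMaximalClique (Adj G) C → Nonempty (s C) →
              ∃ λ C′ → IsMaximalClique (Adj G) C′ × C ≢ C′ × s C ⊆ C ∩ C′
  s⊆overlap {C} peo (clC , _) nonempty with argmin (_∈? s C) pos nonempty
  ... | y , y∈s , least with p⊈q⇒∃ (proj₂ (∈s⁻ y∈s)) | extendToMaximal G (Nσ[]-clique peo y)
  ...   | w , w∈Nσy , w∉C | C′ , maximal′ , Nσ[y]⊆C′ = C′ , maximal′ , C≢C′ , s⊆C∩C′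
    where
    C≢C′ : C ≢ C′
    C≢C′ refl = w∉C (Nσ[]⊆⇒Nσ⊆ Nσ[y]⊆C′ w∈Nσy)
    s⊆C∩C′ : s C ⊆ C ∩ C′
    s⊆C∩C′ {v} v∈s with v ≟ᶠ y
    ... | yes refl = x∈p∩q⁺ (s⊆ v∈s , Nσ[]⊆⇒∈ Nσ[y]⊆C′)
    ... | no v≢y = x∈p∩q⁺ (s⊆ v∈s , Nσ[]⊆⇒Nσ⊆ Nσ[y]⊆C′ (∈Nσ⁺ (clC (s⊆ y∈s) (s⊆ v∈s) (v≢y ∘ sym)) y≺v))
      where
      y≺v : y ≺ v
      y≺v = ≤∧≢⇒< (least v v∈s) (v≢y ∘ sym ∘ pos-injective)

  ∣s∣≤κ̃ : ∀ {κ C} → IsPEO G σ → IsKappaTilde (Adj G) κ → IsMaximalClique (Adj G) C → ∣ s C ∣ ≤ κ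
  ∣s∣≤κ̃ {κ} {C} peo (_ , overlap≤κ) maximal with nonempty? (s C)
  ... | no empty = subst (_≤ κ) (sym (Empty⇒∣p∣≡0 empty)) z≤n
  ... | yes nonempty with s⊆overlap peo maximal nonempty
  ...   | C′ , maximal′ , C≢C′ , s⊆C∩C′ = ≤-trans (p⊆q⇒∣p∣≤∣q∣ s⊆C∩C′) (overlap≤κ C C′ maximal maximal′ C≢C′)

-- An admissible ordering and the graph α_σ(G)

module Admissible {n d : ℕ} (G : SimpleGraph n) (σ : Permutation′ n) (x : Fin d → Fin n)
  (x-injective : Injective _≡_ _≡_ x) (x-clique : ∀ i j → i ≢ j → Adj G (x i) (x j))
  (ω≡d : IsCliqueNumber (Adj G) d) (admissible : IsAdmissible G σ x) where

  open Ordering G σ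
  open IsAdmissible admissible

  d≤n : d ≤ n
  d≤n = injective⇒≤ x-injective

  nσ<d : ∀ u → nσ u < d
  nσ<d u = subst (_≤ d) (∣Nσ[u]∣≡1+nσu u) (proj₂ ω≡d Nσ[ u ] (Nσ[]-clique peo u))

  s⊆Nσ : ∀ {C u} → IsMaximalClique (Adj G) C → u ∈ C → u ∉ s C → s C ⊆ Nσ u
  s⊆Nσ (clC , maximal) u∈C u∉s v∈s =
    ∈Nσ⁺ (clC u∈C (s⊆ v∈s) λ { refl → u∉s v∈s }) (adm-b _ (clC , maximal) _ _ u∈C u∉s v∈s)

  -- By (b), s(C) ⊆ N_σ(u), so (c) applies with i = 1 + nσ u.
  Nσ[]⊆-unique : ∀ {C u v} → IsMaximalClique (Adj G) C → Nσ[ u ] ⊆ C → Nσ[ v ] ⊆ C →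
                 nσ u ≡ nσ v → u ≡ v
  Nσ[]⊆-unique {C} {u} {v} maximal Nσ[u]⊆C Nσ[v]⊆C nσu≡nσv =
    trans (only u (Nσ[]⊆⇒∈ Nσ[u]⊆C) u∉s refl) (sym (only v (Nσ[]⊆⇒∈ Nσ[v]⊆C) v∉s (sym nσu≡nσv)))
    where
    u∉s : u ∉ s C
    u∉s = Nσ⊆⇒∉s (Nσ[]⊆⇒Nσ⊆ Nσ[u]⊆C)
    v∉s : v ∉ s C
    v∉s = Nσ⊆⇒∉s (Nσ[]⊆⇒Nσ⊆ Nσ[v]⊆C)
    only : ∀ w → w ∈ C → w ∉ s C → nσ w ≡ nσ u → w ≡ _
    only = proj₂ (proj₂ (adm-c C maximal (suc (nσ u))
      (s≤s (p⊆q⇒∣p∣≤∣q∣ (s⊆Nσ maximal (Nσ[]⊆⇒∈ Nσ[u]⊆C) u∉s)))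
      (subst (_≤ ∣ C ∣) (∣Nσ[u]∣≡1+nσu u) (p⊆q⇒∣p∣≤∣q∣ Nσ[u]⊆C))))

  -- If u ∉ C′, then u precedes and hence sees all of b, giving u too many forward neighbours.
  Nσ[]⊆-transfer : ∀ {C C′ u b} → IsMaximalClique (Adj G) C → Nσ[ u ] ⊆ C → b ⊆ C → b ⊆ C′ →
                   nσ u < ∣ b ∣ → (∀ a c → a ∈ C → a ∉ C′ → c ∈ C → c ∈ C′ → a ≺ c) →
                   Nσ[ u ] ⊆ C′
  Nσ[]⊆-transfer {C} {C′} {u} {b} (clC , _) Nσ[u]⊆C b⊆C b⊆C′ nσu<∣b∣ C∖C′≺C∩C′ =
    Nσ[]⊆⁺ u∈C′ Nσu⊆C′
    where
    u∈C : u ∈ C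
    u∈C = Nσ[]⊆⇒∈ Nσ[u]⊆C
    b⊆Nσu : u ∉ C′ → b ⊆ Nσ u
    b⊆Nσu u∉C′ c∈b = ∈Nσ⁺ (clC u∈C (b⊆C c∈b) λ { refl → u∉C′ (b⊆C′ c∈b) })
                         (C∖C′≺C∩C′ _ _ u∈C u∉C′ (b⊆C c∈b) (b⊆C′ c∈b))
    u∈C′ : u ∈ C′
    u∈C′ = decidable-stable (u ∈? C′) λ u∉C′ → <⇒≱ nσu<∣b∣ (p⊆q⇒∣p∣≤∣q∣ (b⊆Nσu u∉C′))
    Nσu⊆C′ : Nσ u ⊆ C′
    Nσu⊆C′ {w} w∈Nσu = decidable-stable (w ∈? C′) λ w∉C′ → <-asym (proj₂ (∈Nσ⁻ w∈Nσu))
      (C∖C′≺C∩C′ w u (Nσ[]⊆⇒Nσ⊆ Nσ[u]⊆C w∈Nσu) w∉C′ u∈C u∈C′)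

  Nσ[]⊆-shared : ∀ {C C′ u v b} → IsMaximalClique (Adj G) C → IsMaximalClique (Adj G) C′ →
                 Nσ[ u ] ⊆ C → Nσ[ v ] ⊆ C′ → nσ u ≡ nσ v → b ⊆ C → b ⊆ C′ → nσ u < ∣ b ∣ → u ≡ v
  Nσ[]⊆-shared {C} {C′} {b = b} maximal maximal′ Nσ[u]⊆C Nσ[v]⊆C′ nσu≡nσv b⊆C b⊆C′ nσu<∣b∣
    with ≡-dec _≟ᵇ_ C C′
  ... | yes refl = Nσ[]⊆-unique maximal Nσ[u]⊆C Nσ[v]⊆C′ nσu≡nσv
  ... | no C≢C′ with ∣p∣>0⇒Nonempty (≤-<-trans z≤n nσu<∣b∣)
  ...   | z , z∈b with adm-d C C′ maximal maximal′ C≢C′ (z , b⊆C z∈b , b⊆C′ z∈b)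
  ...     | inj₁ C∖C′≺ = Nσ[]⊆-unique maximal′
              (Nσ[]⊆-transfer maximal Nσ[u]⊆C b⊆C b⊆C′ nσu<∣b∣ C∖C′≺) Nσ[v]⊆C′ nσu≡nσv
  ...     | inj₂ C′∖C≺ = Nσ[]⊆-unique maximal Nσ[u]⊆C
              (Nσ[]⊆-transfer maximal′ Nσ[v]⊆C′ b⊆C′ b⊆C (subst (_< ∣ b ∣) nσu≡nσv nσu<∣b∣)
                 λ a c a∈C′ a∉C c∈C′ c∈C → C′∖C≺ a c a∈C′ a∉C c∈C c∈C′)
              nσu≡nσv

  InK : Fin n → Set
  InK = D.InK G σ x

  InK? : Decidable InK
  InK? v = any? λ r → x r ≟ᶠ v

  -- K< k = {x_1, …, x_k} in the paper's indexing
  K< : ℕ → Subset n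
  K< k = tabulate λ v → isYes (any? λ r → toℕ r <? k ×-dec x r ≟ᶠ v)

  K : Subset n
  K = K< d

  ∈K<⁻ : ∀ {k v} → v ∈ K< k → ∃ λ r → toℕ r < k × x r ≡ v
  ∈K<⁻ v∈ = toWitness (∈-tabulate⁻ v∈)

  x∈K< : ∀ {k r} → toℕ r < k → x r ∈ K< k
  x∈K< r<k = ∈-tabulate⁺ (fromWitness (_ , r<k , refl))

  x∈K<⁻ : ∀ {k r} → x r ∈ K< k → toℕ r < k
  x∈K<⁻ x∈ with ∈K<⁻ x∈
  ... | _ , r′<k , e = subst (λ r → toℕ r < _) (x-injective e) r′<k

  K<⇒InK : ∀ {k v} → v ∈ K< k → InK v
  K<⇒InK v∈ with ∈K<⁻ v∈
  ... | r , _ , e = r , e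

  InK⇒∈K : ∀ {v} → InK v → v ∈ K
  InK⇒∈K (r , refl) = x∈K< (toℕ<n r)

  K<-suc : ∀ r → K< (suc (toℕ r)) ≡ K< (toℕ r) ∪ ⁅ x r ⁆
  K<-suc r = ⊆-antisym ⊆∪ ∪⊆
    where
    ⊆∪ : K< (suc (toℕ r)) ⊆ K< (toℕ r) ∪ ⁅ x r ⁆
    ⊆∪ v∈ with ∈K<⁻ v∈
    ... | r′ , r′<1+r , refl with toℕ r′ <? toℕ r
    ...   | yes r′<r = p⊆p∪q ⁅ x r ⁆ (x∈K< r′<r)
    ...   | no r′≮r = subst (λ r″ → x r′ ∈ K< (toℕ r) ∪ ⁅ x r″ ⁆)
                        (toℕ-injective (≤-antisym (s≤s⁻¹ r′<1+r) (≮⇒≥ r′≮r))) (y∈p∪⁅y⁆ _ (x r′))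
    ∪⊆ : K< (toℕ r) ∪ ⁅ x r ⁆ ⊆ K< (suc (toℕ r))
    ∪⊆ v∈ with x∈p∪⁅y⁆⁻ v∈
    ... | inj₁ v∈K< with ∈K<⁻ v∈K<
    ...   | r′ , r′<r , refl = x∈K< (m<n⇒m<1+n r′<r)
    ∪⊆ v∈ | inj₂ refl = x∈K< (n<1+n (toℕ r))

  ∣K<k∣≡k : ∀ {k} → k ≤ d → ∣ K< k ∣ ≡ k
  ∣K<k∣≡k {zero} _ = Empty⇒∣p∣≡0 λ (_ , v∈) → n≮0 (proj₁ (proj₂ (∈K<⁻ v∈)))
  ∣K<k∣≡k {suc k} k<d = begin
    ∣ K< (suc k) ∣             ≡⟨ cong (∣_∣ ∘ K< ∘ suc) (sym (toℕ-fromℕ< k<d)) ⟩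
    ∣ K< (suc (toℕ r)) ∣       ≡⟨ cong ∣_∣ (K<-suc r) ⟩
    ∣ K< (toℕ r) ∪ ⁅ x r ⁆ ∣   ≡⟨ x∉p⇒∣p∪⁅x⁆∣≡1+∣p∣ (<-irrefl refl ∘ x∈K<⁻) ⟩
    suc ∣ K< (toℕ r) ∣         ≡⟨ cong (suc ∘ ∣_∣ ∘ K<) (toℕ-fromℕ< k<d) ⟩
    suc ∣ K< k ∣               ≡⟨ cong suc (∣K<k∣≡k (<⇒≤ k<d)) ⟩
    suc k                      ∎
    where
    open ≡-Reasoning
    r : Fin d
    r = fromℕ< k<d

  ∣K∣≡d : ∣ K ∣ ≡ d
  ∣K∣≡d = ∣K<k∣≡k ≤-refl

  x≺x⁺ : ∀ {j r} → toℕ r < toℕ j → x j ≺ x r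
  x≺x⁺ {j} {r} r<j = subst₂ _<_ (sym (adm-a₂ j)) (sym (adm-a₂ r))
    (∸-monoʳ-< (s≤s r<j) (<-≤-trans (toℕ<n j) d≤n))

  x≺x⁻ : ∀ {j r} → x j ≺ x r → toℕ r < toℕ j
  x≺x⁻ {j} {r} xj≺xr with <-cmp (toℕ r) (toℕ j)
  ... | tri< r<j _ _ = r<j
  ... | tri≈ _ r≡j _ = contradiction (subst (λ r′ → x j ≺ x r′) (toℕ-injective r≡j) xj≺xr) (<-irrefl refl)
  ... | tri> _ _ j<r = contradiction xj≺xr (<-asym (x≺x⁺ j<r))

  Nσ-x : ∀ j → Nσ (x j) ≡ K< (toℕ j)
  Nσ-x j = ⊆-antisym ⊆K< K<⊆
    where
    ⊆K< : Nσ (x j) ⊆ K< (toℕ j)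
    ⊆K< {w} w∈ with InK? w
    ... | yes (r , refl) = x∈K< (x≺x⁻ (proj₂ (∈Nσ⁻ w∈)))
    ... | no w∉K = contradiction (adm-a₁ w (x j) w∉K (j , refl)) (<-asym (proj₂ (∈Nσ⁻ w∈)))
    K<⊆ : K< (toℕ j) ⊆ Nσ (x j)
    K<⊆ w∈ with ∈K<⁻ w∈
    ... | r , r<j , refl = ∈Nσ⁺ (x-clique j r λ { refl → <-irrefl refl r<j }) (x≺x⁺ r<j)

  nσ-x : ∀ j → nσ (x j) ≡ toℕ j
  nσ-x j = trans (cong ∣_∣ (Nσ-x j)) (∣K<k∣≡k (<⇒≤ (toℕ<n j)))

  ⊆K⊎∃∉K : ∀ C → C ⊆ K ⊎ ∃ λ u → u ∈ C × ¬ InK u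
  ⊆K⊎∃∉K C with any? (λ v → v ∈? C ×-dec ¬? (InK? v))
  ... | yes found = inj₂ found
  ... | no none = inj₁ λ {v} v∈C → InK⇒∈K (decidable-stable (InK? v) λ v∉K → none (v , v∈C , v∉K))

  α : Rel n
  α = αAdj G σ x

  α-sym : ∀ {a b} → α a b → α b a
  α-sym = swap

  α-K : ∀ {a b} → InK a → InK b → a ≢ b → α a b
  α-K (r , refl) (r′ , refl) xr≢xr′ = inj₁ (keep (x-clique r r′ (xr≢xr′ ∘ cong x)) (r , refl) (r′ , refl))

  α-nbr : ∀ {u v} → ¬ InK u → α u v → ∃ λ r → v ≡ x r × toℕ r < nσ u
  α-nbr u∉K (inj₁ (keep _ u∈K _)) = contradiction u∈K u∉K
  α-nbr {u} _ (inj₁ (move r adj _ u≺v r≡rank)) =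
    r , refl , subst (_< nσ u) (sym r≡rank) (rank<nσ (∈Nσ⁺ adj u≺v))
  α-nbr u∉K (inj₂ (keep _ _ u∈K)) = contradiction u∈K u∉K
  α-nbr u∉K (inj₂ (move r _ _ _ _)) = contradiction (r , refl) u∉K

  α-x : ∀ {u r} → ¬ InK u → toℕ r < nσ u → α u (x r)
  α-x u∉K r<nσu with rank-surjective _ r<nσu
  ... | w , w∈ , rank≡r = inj₁ (move _ (proj₁ (∈Nσ⁻ w∈)) u∉K (proj₂ (∈Nσ⁻ w∈)) (sym rank≡r))

  K<-α-clique : ∀ {k} → IsClique α (K< k)
  K<-α-clique a∈ b∈ = α-K (K<⇒InK a∈) (K<⇒InK b∈)

  fan : ℕ → Fin n → Subset n
  fan m u = K< m ∪ ⁅ u ⁆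

  α-clique⊆fan : ∀ {C u} → IsClique α C → u ∈ C → ¬ InK u → C ⊆ fan (nσ u) u
  α-clique⊆fan {u = u} cl u∈C u∉K {v} v∈C with v ≟ᶠ u
  ... | yes refl = y∈p∪⁅y⁆ _ v
  ... | no v≢u with α-nbr u∉K (cl u∈C v∈C (v≢u ∘ sym))
  ...   | r , refl , r<nσu = p⊆p∪q _ (x∈K< r<nσu)

  fan-α-clique : ∀ {m u} → m ≤ nσ u → IsClique α (fan m u)
  fan-α-clique {m} {u} m≤nσu = ∪-clique α-sym K<-α-clique (⁅⁆-clique {R = α}) cross
    where
    cross : ∀ {a b} → a ∈ K< m → b ∈ ⁅ u ⁆ → a ≢ b → α a b
    cross a∈ b∈ a≢b with ∈K<⁻ a∈ | x∈⁅y⁆⇒x≡y u b∈ | InK? u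
    ... | _ , _ , refl     | refl | yes u∈K = α-K (K<⇒InK a∈) u∈K a≢b
    ... | r , r<m , refl   | refl | no u∉K  = α-sym (α-x u∉K (<-≤-trans r<m m≤nσu))

  ∣fan∣ : ∀ {m u} → m ≤ d → m ≤ nσ u → ∣ fan m u ∣ ≡ suc m
  ∣fan∣ {m} {u} m≤d m≤nσu = trans (x∉p⇒∣p∪⁅x⁆∣≡1+∣p∣ u∉K<m) (cong suc (∣K<k∣≡k m≤d))
    where
    u∉K<m : u ∉ K< m
    u∉K<m u∈ with ∈K<⁻ u∈
    ... | r , r<m , refl = <-irrefl refl (<-≤-trans r<m (subst (m ≤_) (nσ-x r) m≤nσu))

  α-clique≤d : ∀ C → IsClique α C → ∣ C ∣ ≤ d
  α-clique≤d C cl with ⊆K⊎∃∉K C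
  ... | inj₁ C⊆K = ≤-trans (p⊆q⇒∣p∣≤∣q∣ C⊆K) (≤-reflexive ∣K∣≡d)
  ... | inj₂ (u , u∈C , u∉K) = begin
    ∣ C ∣                ≤⟨ p⊆q⇒∣p∣≤∣q∣ (α-clique⊆fan cl u∈C u∉K) ⟩
    ∣ fan (nσ u) u ∣     ≡⟨ ∣fan∣ (<⇒≤ (nσ<d u)) ≤-refl ⟩
    suc (nσ u)           ≤⟨ nσ<d u ⟩
    d                    ∎
    where open ≤-Reasoning

  K-α-maximal : IsMaximalClique α K
  K-α-maximal = maximum⇒maximal α-clique≤d K<-α-clique ∣K∣≡d

  fan-α-maximal : ∀ {u} → ¬ InK u → IsMaximalClique α (fan (nσ u) u)
  fan-α-maximal {u} u∉K =
    fan-α-clique ≤-refl , λ C′ cl′ fan⊆C′ → α-clique⊆fan cl′ (fan⊆C′ (y∈p∪⁅y⁆ _ u)) u∉K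

  -- the order is i = suc k
  module Order (k : ℕ) (k<d : k < d) where

    hasDegree? : Decidable λ v → nσ v ≡ k
    hasDegree? v = nσ v ≟ k

    L : List (Fin n)
    L = filter hasDegree? (allFin n)

    ∈L⁻ : ∀ {t} → t ∈ˡ L → nσ t ≡ k
    ∈L⁻ t∈L = proj₂ (∈-filter⁻ hasDegree? {xs = allFin n} t∈L)

    ∈L⁺ : ∀ {t} → nσ t ≡ k → t ∈ˡ L
    ∈L⁺ {t} nσt≡k = ∈-filter⁺ hasDegree? (∈-allFin t) nσt≡k

    L-unique : Unique L
    L-unique = Unique.filter⁺ hasDegree? (Unique.allFin⁺ n)

    xₖ : Fin n
    xₖ = x (fromℕ< k<d)

    xₖ∈L : xₖ ∈ˡ L
    xₖ∈L = ∈L⁺ (trans (nσ-x _) (toℕ-fromℕ< k<d))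

    L-InK : ∀ {t} → t ∈ˡ L → InK t → t ≡ xₖ
    L-InK t∈L (r , refl) =
      cong x (toℕ-injective (trans (trans (sym (nσ-x r)) (∈L⁻ t∈L)) (sym (toℕ-fromℕ< k<d))))

    ∈L⇒∉K<k : ∀ {t} → t ∈ˡ L → t ∉ K< k
    ∈L⇒∉K<k t∈L t∈ with ∈K<⁻ t∈
    ... | r , r<k , refl = <-irrefl (trans (sym (nσ-x r)) (∈L⁻ t∈L)) r<k

    ∣b∣≤k : ∀ {b} → b ⊆ K< k → ∣ b ∣ ≤ k
    ∣b∣≤k b⊆ = ≤-trans (p⊆q⇒∣p∣≤∣q∣ b⊆) (≤-reflexive (∣K<k∣≡k (<⇒≤ k<d)))

    ∣fan∣≡1+k : ∀ {t} → t ∈ˡ L → ∣ fan k t ∣ ≡ suc k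
    ∣fan∣≡1+k t∈L = ∣fan∣ (<⇒≤ k<d) (≤-reflexive (sym (∈L⁻ t∈L)))

    fan-xₖ : fan k xₖ ≡ K< (suc k)
    fan-xₖ = subst (λ m → K< m ∪ ⁅ xₖ ⁆ ≡ K< (suc m)) (toℕ-fromℕ< k<d) (sym (K<-suc (fromℕ< k<d)))

    Dα : List (Subset n)
    Dα = map (fan k) L

    Dα-dominating : IsDominatingIClique α (suc k) Dα
    Dα-dominating = Unique-map⁺ (fan k) L-unique fan-injective , cliques , dominates
      where
      fan-injective : ∀ {t t′} → t ∈ˡ L → t′ ∈ˡ L → fan k t ≡ fan k t′ → t ≡ t′
      fan-injective {t} t∈L _ e with x∈p∪⁅y⁆⁻ (subst (t ∈_) e (y∈p∪⁅y⁆ _ t))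
      ... | inj₁ t∈K<k = contradiction t∈K<k (∈L⇒∉K<k t∈L)
      ... | inj₂ t≡t′  = t≡t′
      cliques : All (IsICliqueOf α (suc k)) Dα
      cliques = All.map⁺ (All.tabulate λ t∈L → fan-α-clique (≤-reflexive (sym (∈L⁻ t∈L))) , ∣fan∣≡1+k t∈L)
      dominated : ∀ {t C} → t ∈ˡ L → fan k t ⊆ C → Any (_⊆ C) Dα
      dominated t∈L fan⊆C = Any.map⁺ (lose t∈L fan⊆C)
      dominated-by-K : ∀ {C} → K< (suc k) ⊆ C → Any (_⊆ C) Dα
      dominated-by-K K⊆C = dominated xₖ∈L (K⊆C ∘ subst (_ ∈_) fan-xₖ)
      dominates : ∀ C → IsMaximalClique α C → suc k ≤ ∣ C ∣ → Any (_⊆ C) Dα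
      dominates C maximal k<∣C∣ with ⊆K⊎∃∉K C
      ... | inj₁ C⊆K = dominated-by-K (⊆-maximal α-sym maximal K<-α-clique λ a∈C b∈K a≢b →
                         α-K (K<⇒InK (C⊆K a∈C)) (K<⇒InK b∈K) a≢b)
      ... | inj₂ (u , u∈C , u∉K) with <-cmp (nσ u) k
      ...   | tri< nσu<k _ _ = contradiction (≤-trans k<∣C∣ C≤) (<⇒≱ (s≤s nσu<k))
        where
        C≤ : ∣ C ∣ ≤ suc (nσ u)
        C≤ = ≤-trans (p⊆q⇒∣p∣≤∣q∣ (α-clique⊆fan (proj₁ maximal) u∈C u∉K))
                     (≤-reflexive (∣fan∣ (<⇒≤ (nσ<d u)) ≤-refl))
      ...   | tri≈ _ nσu≡k _ = dominated (∈L⁺ nσu≡k) (p⊆q∧∣q∣≤∣p∣⇒q⊆p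
              (subst (λ m → C ⊆ fan m u) nσu≡k (α-clique⊆fan (proj₁ maximal) u∈C u∉K))
              (≤-trans (≤-reflexive (∣fan∣≡1+k (∈L⁺ nσu≡k))) k<∣C∣))
      ...   | tri> _ _ k<nσu = dominated-by-K (⊆-maximal α-sym maximal K<-α-clique cross)
        where
        cross : ∀ {a b} → a ∈ C → b ∈ K< (suc k) → a ≢ b → α a b
        cross {a} a∈C b∈ a≢b with ∈K<⁻ b∈ | a ≟ᶠ u
        ... | r , r≤k , refl | yes refl = α-x u∉K (<-≤-trans r≤k k<nσu)
        ... | r , _ , refl   | no a≢u with α-nbr u∉K (proj₁ maximal u∈C a∈C (a≢u ∘ sym))
        ...   | r′ , refl , _ = α-K (r′ , refl) (r , refl) a≢b

    Cα : Fin n → Subset n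
    Cα t with InK? t
    ... | yes _ = K
    ... | no _  = fan k t

    Cα-maximal : ∀ {t} → t ∈ˡ L → IsMaximalClique α (Cα t) × suc k ≤ ∣ Cα t ∣
    Cα-maximal {t} t∈L with InK? t
    ... | yes _   = K-α-maximal , subst (suc k ≤_) (sym ∣K∣≡d) k<d
    ... | no t∉K  = subst (λ m → IsMaximalClique α (fan m t)) (∈L⁻ t∈L) (fan-α-maximal t∉K)
                  , ≤-reflexive (sym (∣fan∣≡1+k t∈L))

    fan-escape : ∀ {t v} → v ∈ fan k t → v ≢ t → v ∈ K< k
    fan-escape v∈ v≢t with x∈p∪⁅y⁆⁻ v∈
    ... | inj₁ v∈K<k = v∈K<k
    ... | inj₂ v≡t   = contradiction v≡t v≢t

    Cα-overlap : ∀ {t t′ v} → t ∈ˡ L → t′ ∈ˡ L → t ≢ t′ → v ∈ Cα t → v ∈ Cα t′ → v ∈ K< k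
    Cα-overlap {t} {t′} {v} t∈L t′∈L t≢t′ v∈ v∈′ with InK? t | InK? t′
    ... | yes t∈K | yes t′∈K = contradiction (trans (L-InK t∈L t∈K) (sym (L-InK t′∈L t′∈K))) t≢t′
    ... | yes _   | no t′∉K  = fan-escape v∈′ λ { refl → t′∉K (K<⇒InK v∈) }
    ... | no t∉K  | yes _    = fan-escape v∈ λ { refl → t∉K (K<⇒InK v∈′) }
    ... | no _    | no _ with v ≟ᶠ t
    ...   | no v≢t   = fan-escape v∈ v≢t
    ...   | yes refl = contradiction (fan-escape v∈′ t≢t′) (∈L⇒∉K<k t∈L)

    α-lower : ∀ D → IsDominatingIClique α (suc k) D → length L ≤ length D
    α-lower D (_ , cliques , dominates) =
      matching⇒length≤ (λ t b → b ⊆ Cα t) L-unique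
        (λ t∈L → dominates _ (proj₁ (Cα-maximal t∈L)) (proj₂ (Cα-maximal t∈L)))
        λ {t} {t′} t∈L t′∈L b∈D b⊆Cαt b⊆Cαt′ → decidable-stable (t ≟ᶠ t′) λ t≢t′ →
          <-irrefl (proj₂ (All.lookup cliques b∈D))
            (s≤s (∣b∣≤k λ v∈b → Cα-overlap t∈L t′∈L t≢t′ (b⊆Cαt v∈b) (b⊆Cαt′ v∈b)))

    CG : Fin n → Subset n
    CG t = proj₁ (extendToMaximal G (Nσ[]-clique peo t))

    CG-maximal : ∀ {t} → IsMaximalClique (Adj G) (CG t)
    CG-maximal {t} = proj₁ (proj₂ (extendToMaximal G (Nσ[]-clique peo t)))

    Nσ[]⊆CG : ∀ {t} → Nσ[ t ] ⊆ CG t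
    Nσ[]⊆CG {t} = proj₂ (proj₂ (extendToMaximal G (Nσ[]-clique peo t)))

    ∣Nσ[]∣≡1+k : ∀ {t} → t ∈ˡ L → ∣ Nσ[ t ] ∣ ≡ suc k
    ∣Nσ[]∣≡1+k {t} t∈L = trans (∣Nσ[u]∣≡1+nσu t) (cong suc (∈L⁻ t∈L))

    G-lower : ∀ D → IsDominatingIClique (Adj G) (suc k) D → length L ≤ length D
    G-lower D (_ , cliques , dominates) =
      matching⇒length≤ (λ t b → b ⊆ CG t) L-unique
        (λ t∈L → dominates _ CG-maximal
          (≤-trans (≤-reflexive (sym (∣Nσ[]∣≡1+k t∈L))) (p⊆q⇒∣p∣≤∣q∣ Nσ[]⊆CG)))
        λ t∈L t′∈L b∈D b⊆CGt b⊆CGt′ → Nσ[]⊆-shared CG-maximal CG-maximal Nσ[]⊆CG Nσ[]⊆CG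
          (trans (∈L⁻ t∈L) (sym (∈L⁻ t′∈L))) b⊆CGt b⊆CGt′
          (subst (_< _) (sym (∈L⁻ t∈L)) (≤-reflexive (sym (proj₂ (All.lookup cliques b∈D)))))

    DG : List (Subset n)
    DG = map Nσ[_] L

    DG-dominating : ∀ {κ} → IsKappaTilde (Adj G) κ → κ < suc k → IsDominatingIClique (Adj G) (suc k) DG
    DG-dominating κ̃ κ<1+k =
      Unique.map⁺ Nσ[]-injective L-unique ,
      All.map⁺ (All.tabulate λ t∈L → Nσ[]-clique peo _ , ∣Nσ[]∣≡1+k t∈L) ,
      dominates
      where
      dominates : ∀ C → IsMaximalClique (Adj G) C → suc k ≤ ∣ C ∣ → Any (_⊆ C) DG
      dominates C maximal k<∣C∣
        with adm-c C maximal (suc k) (≤-<-trans (∣s∣≤κ̃ peo κ̃ maximal) κ<1+k) k<∣C∣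
      ... | u , (u∈C , u∉s , nσu≡k) , _ = Any.map⁺ (lose (∈L⁺ nσu≡k) (Nσ[]⊆⁺ u∈C (∉s⇒Nσ⊆ u∈C u∉s)))

    dα≡∣L∣ : ∀ {m} → IsDominationNumber α (suc k) m → m ≡ length L
    dα≡∣L∣ dα = ≤-antisym
      (≤-trans (dominationNumber≤ dα Dα-dominating) (≤-reflexive (length-map (fan k) L)))
      (≤dominationNumber dα α-lower)

    ∣L∣≤dG : ∀ {m} → IsDominationNumber (Adj G) (suc k) m → length L ≤ m
    ∣L∣≤dG dG = ≤dominationNumber dG G-lower

    dG≡∣L∣ : ∀ {κ m} → IsKappaTilde (Adj G) κ → κ < suc k → IsDominationNumber (Adj G) (suc k) m → m ≡ length L
    dG≡∣L∣ κ̃ κ<1+k dG = ≤-antisym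
      (≤-trans (dominationNumber≤ dG (DG-dominating κ̃ κ<1+k)) (≤-reflexive (length-map Nσ[_] L)))
      (∣L∣≤dG dG)

  dα≤dG : ∀ i → 1 ≤ i → i ≤ d → ∀ mT mG →
          IsDominationNumber α i mT → IsDominationNumber (Adj G) i mG → mT ≤ mG
  dα≤dG (suc k) _ k<d _ _ dα dG = ≤-trans (≤-reflexive (dα≡∣L∣ dα)) (∣L∣≤dG dG)
    where open Order k k<d

  dα≡dG : ∀ κ → IsKappaTilde (Adj G) κ → ∀ i → κ < i → ∀ mT mG →
          IsDominationNumber α i mT → IsDominationNumber (Adj G) i mG → mT ≡ mG
  dα≡dG κ κ̃ (suc k) κ<1+k _ _ dα dG with k <? d
  ... | yes k<d = trans (dα≡∣L∣ dα) (sym (dG≡∣L∣ κ̃ κ<1+k dG))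
    where open Order k k<d
  ... | no k≮d = trans (dominationNumber-vanishes (λ C cl → s≤s (≤-trans (α-clique≤d C cl) d≤k)) dα)
                       (sym (dominationNumber-vanishes (λ C cl → s≤s (≤-trans (proj₂ ω≡d C cl) d≤k)) dG))
    where
    d≤k : d ≤ k
    d≤k = ≮⇒≥ k≮d

theorem5p8 : ∀ {n d : ℕ} (G : SimpleGraph n) → IsChordal G → ¬ IsComplete G →
    IsCliqueNumber (Adj G) d →
    (x : Fin d → Fin n) → Injective _≡_ _≡_ x →
    (∀ i j → i ≢ j → Adj G (x i) (x j)) →
    (σ : Permutation′ n) → IsAdmissible G σ x →
    (∀ i → 1 ≤ i → i ≤ d → ∀ mT mG →
      IsDominationNumber (αAdj G σ x) i mT → IsDominationNumber (Adj G) i mG →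
      mT ≤ mG)
    ×
    (∀ k → IsKappaTilde (Adj G) k → ∀ i → k < i → ∀ mT mG →
      IsDominationNumber (αAdj G σ x) i mT → IsDominationNumber (Adj G) i mG →
      mT ≡ mG)
-- Chordality and non-completeness only serve to make an admissible σ exist.
theorem5p8 G _ _ ω≡d x x-injective x-clique σ admissible = dα≤dG , dα≡dG
  where open Admissible G σ x x-injective x-clique ω≡d admissible
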